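{- Every formula provable in $\mathsf{ATC}+(\mathrm{Df}.P_F)+(\mathrm{Df}.A_F)$ is provable in $\mathsf{AEM}_{\mathsf{pl}}+(\mathrm{Df}.aa_P)+(\mathrm{Df}.\mathfrak{at}^{ind}_P)+(\mathrm{Df}.\mathfrak{at}^{pl}_P)$, i.e. $\mathsf{ATC}+(\mathrm{Df}.P_F)+(\mathrm{Df}.A_F)\subseteq\mathsf{AEM}_{\mathsf{pl}}+(\mathrm{Df}.aa_P)+(\mathrm{Df}.\mathfrak{at}^{ind}_P)+(\mathrm{Df}.\mathfrak{at}^{pl}_P)$.
   Context: Language: two-sorted classical logic with individual variables $x,y,z,\dots$ and plural variables $xx,yy,zz,\dots$; identity $=$ between individual terms; the predicate $x\prec tt$ ("$x$ is one of $tt$"), individual on the left, plural term on the right. Abbreviations: $tt\preccurlyeq ss := \forall z(z\prec tt\to z\prec ss)\land \exists x(x\prec tt)$; $tt\approx ss := \forall x(x\prec tt\leftrightarrow x\prec ss)$; $\forall_{z\prec tt}\varphi:=\forall z(z\prec tt\to\varphi)$, $\exists_{z\prec tt}\varphi:=\exists z(z\prec tt\land\varphi)$, $\forall_{yy\preccurlyeq tt}\varphi:=\forall yy(yy\preccurlyeq tt\to\varphi)$, $\exists_{yy\preccurlyeq tt}\varphi:=\exists yy(yy\preccurlyeq tt\land\varphi)$. No plural comprehension schema is assumed and plurals may be empty. All axioms below are universally closed. $\mathsf{ATC}$: single non-logical primitive $F$, written $F_{tt}x$ ("$x$ is a composition of $tt$"); plural terms are plural variables, a constant $aa$, and $\mathfrak{at}_{tt}$.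 Axioms: $x\prec aa\leftrightarrow \forall yy\,\forall_{z\prec yy}(F_{yy}x\to z=x)$; $x\prec \mathfrak{at}_{zz}\leftrightarrow \exists_{y\prec zz}\exists_{yy\preccurlyeq aa}(F_{yy}y\land x\prec yy)$; (ATC1) $\forall x\,\exists_{zz\preccurlyeq aa}\big(F_{zz}x\land \forall_{yy\preccurlyeq aa}(F_{yy}x\leftrightarrow zz\approx yy)\land\forall y(F_{zz}y\to x=y)\big)$; (ATC2) $F_{zz}x\leftrightarrow F_{\mathfrak{at}_{zz}}x$. Using (ATC1), $\mathsf{ATC}$ is extended by plural terms $\mathfrak{at}_x$ characterized by $\mathfrak{at}_{x}\preccurlyeq aa \land F_{\mathfrak{at}_{x}}x \land \forall_{yy\preccurlyeq aa}(F_{yy}x\leftrightarrow yy\approx\mathfrak{at}_{x})\land \forall y (F_{\mathfrak{at}_{x}}y\to x=y)$. (Df.$P_F$): $Pxy\leftrightarrow\mathfrak{at}_x\preccurlyeq\mathfrak{at}_y$; (Df.$A_F$): $Ax\leftrightarrow x\prec aa$. $\mathsf{AEM}_{\mathsf{pl}}$: primitive binary predicate $P$ ("is a part of"), $Oxy:=\exists z(Pzx\land Pzy)$; axioms $Pxx$; $Pxy\land Pyz\to Pxz$; $Pxy\land Pyx\to x=y$; $\neg Pxy\to\exists z(Pzx\land\neg Ozy)$; definitions $Ax\leftrightarrow\forall y(Pyx\to x=y)$ and $F_{tt}x\leftrightarrow \forall_{z\prec tt}Pzx\land\forall y(Pyx\to\exists_{z\prec tt}Ozy)$; atomicity axiom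 $\forall x\exists y(Pyx\land Ay)$. (Df.$aa_P$): $x\prec aa\leftrightarrow Ax$; (Df.$\mathfrak{at}^{ind}_P$): $y\prec\mathfrak{at}_x\leftrightarrow Pyx\land y\prec aa$; (Df.$\mathfrak{at}^{pl}_P$): $y\prec\mathfrak{at}_{xx}\leftrightarrow\exists z(z\prec xx\land Pyz\land y\prec aa)$. In the inclusion, the symbols $F,aa,\mathfrak{at}_{tt},\mathfrak{at}_x,P,A$ are read in $\mathsf{AEM}_{\mathsf{pl}}$ via its primitive $P$ and the definitions above. -}

module Defs where

-- Syntax and a classical natural-deduction calculus for two-sorted
-- (individual / plural) first-order logic, in the common language of
-- ATC + (Df.P_F) + (Df.A_F) and AEM_pl + (Df.aa_P) + (Df.at^ind_P) + (Df.at^pl_P):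
--   predicates  = (individual identity), ≺ , F_tt x , P x y , A x
--   plural terms: plural variables, aa , at_tt , at_x
-- Variables are de Bruijn indices; a formula in  Form n m  has at most
-- n free individual and m free plural variables (index 0 = innermost binder).

open import Data.Nat using (ℕ; zero; suc)
open import Data.Fin using (Fin; zero; suc; #_)
open import Data.List using (List; []; _∷_; map)
open import Data.List.Membership.Propositional using (_∈_)

infix  7 _≐_ _≺_
infixr 6 _∧'_
infixr 5 _⊃_ _⇔_
infix  8 ¬'_

data PTerm (n m : ℕ) : Set where
  pvar : Fin m → PTerm n m
  aa   : PTerm n m
  atp  : PTerm n m → PTerm n m
  ati  : Fin n → PTerm n m

data Form (n m : ℕ) : Set where
  _≐_   : Fin n → Fin n → Form n m
  _≺_   : Fin n → PTerm n m → Form n m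
  Fm    : PTerm n m → Fin n → Form n m
  Pm    : Fin n → Fin n → Form n m
  Am    : Fin n → Form n m
  falsum : Form n m
  _⊃_   : Form n m → Form n m → Form n m
  ∀i    : Form (suc n) m → Form n m
  ∀p    : Form n (suc m) → Form n m

renT : ∀ {n n' m m'} → (Fin n → Fin n') → (Fin m → Fin m') → PTerm n m → PTerm n' m'
renT ρ τ (pvar j) = pvar (τ j)
renT ρ τ aa       = aa
renT ρ τ (atp t)  = atp (renT ρ τ t)
renT ρ τ (ati x)  = ati (ρ x)

subT : ∀ {n n' m m'} → (Fin n → Fin n') → (Fin m → PTerm n' m') → PTerm n m → PTerm n' m'
subT ρ σ (pvar j) = σ j
subT ρ σ aa       = aa
subT ρ σ (atp t)  = atp (subT ρ σ t)
subT ρ σ (ati x)  = ati (ρ x)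

liftI : ∀ {n n'} → (Fin n → Fin n') → Fin (suc n) → Fin (suc n')
liftI ρ zero    = zero
liftI ρ (suc i) = suc (ρ i)

liftP : ∀ {n m m'} → (Fin m → PTerm n m') → Fin (suc m) → PTerm n (suc m')
liftP σ zero    = pvar zero
liftP σ (suc j) = renT (λ i → i) suc (σ j)

sub : ∀ {n n' m m'} → (Fin n → Fin n') → (Fin m → PTerm n' m') → Form n m → Form n' m'
sub ρ σ (x ≐ y)   = ρ x ≐ ρ y
sub ρ σ (x ≺ t)   = ρ x ≺ subT ρ σ t
sub ρ σ (Fm t x)  = Fm (subT ρ σ t) (ρ x)
sub ρ σ (Pm x y)  = Pm (ρ x) (ρ y)
sub ρ σ (Am x)    = Am (ρ x)
sub ρ σ falsum    = falsum
sub ρ σ (φ ⊃ ψ)   = sub ρ σ φ ⊃ sub ρ σ ψ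
sub ρ σ (∀i φ)    = ∀i (sub (liftI ρ) (λ j → renT suc (λ k → k) (σ j)) φ)
sub ρ σ (∀p φ)    = ∀p (sub ρ (liftP σ) φ)

wkTI : ∀ {n m} → PTerm n m → PTerm (suc n) m
wkTI = renT suc (λ k → k)

wkTP : ∀ {n m} → PTerm n m → PTerm n (suc m)
wkTP = renT (λ i → i) suc

wkI : ∀ {n m} → Form n m → Form (suc n) m
wkI = sub suc pvar

wkP : ∀ {n m} → Form n m → Form n (suc m)
wkP = sub (λ i → i) (λ j → pvar (suc j))

instI : ∀ {n m} → Form (suc n) m → Fin n → Form n m
instI φ x = sub (λ { zero → x ; (suc i) → i }) pvar φ

instP : ∀ {n m} → Form n (suc m) → PTerm n m → Form n m
instP φ t = sub (λ i → i) (λ { zero → t ; (suc j) → pvar j }) φ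

close : ∀ {n m} → Form 0 0 → Form n m
close = sub (λ ()) (λ ())

¬'_ : ∀ {n m} → Form n m → Form n m
¬' φ = φ ⊃ falsum

_∧'_ : ∀ {n m} → Form n m → Form n m → Form n m
φ ∧' ψ = ¬' (φ ⊃ ¬' ψ)

_⇔_ : ∀ {n m} → Form n m → Form n m → Form n m
φ ⇔ ψ = (φ ⊃ ψ) ∧' (ψ ⊃ φ)

∃i : ∀ {n m} → Form (suc n) m → Form n m
∃i φ = ¬' ∀i (¬' φ)

∃p : ∀ {n m} → Form n (suc m) → Form n m
∃p φ = ¬' ∀p (¬' φ)

∀≺ : ∀ {n m} → PTerm n m → Form (suc n) m → Form n m
∀≺ t φ = ∀i ((zero ≺ wkTI t) ⊃ φ)

∃≺ : ∀ {n m} → PTerm n m → Form (suc n) m → Form n m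
∃≺ t φ = ∃i ((zero ≺ wkTI t) ∧' φ)

_≼_ : ∀ {n m} → PTerm n m → PTerm n m → Form n m
t ≼ s = ∀i ((zero ≺ wkTI t) ⊃ (zero ≺ wkTI s)) ∧' ∃i (zero ≺ wkTI t)

_≈_ : ∀ {n m} → PTerm n m → PTerm n m → Form n m
t ≈ s = ∀i ((zero ≺ wkTI t) ⇔ (zero ≺ wkTI s))

∀≼ : ∀ {n m} → PTerm n m → Form n (suc m) → Form n m
∀≼ t φ = ∀p ((pvar zero ≼ wkTP t) ⊃ φ)

∃≼ : ∀ {n m} → PTerm n m → Form n (suc m) → Form n m
∃≼ t φ = ∃p ((pvar zero ≼ wkTP t) ∧' φ)

Om : ∀ {n m} → Fin n → Fin n → Form n m
Om x y = ∃i (Pm zero (suc x) ∧' Pm zero (suc y))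

data Der (T : Form 0 0 → Set) : ∀ {n m} → List (Form n m) → Form n m → Set where
  ax    : ∀ {n m} {Δ : List (Form n m)} {ψ} → T ψ → Der T Δ (close ψ)
  hyp   : ∀ {n m} {Δ : List (Form n m)} {φ} → φ ∈ Δ → Der T Δ φ
  ⊃I    : ∀ {n m} {Δ : List (Form n m)} {φ ψ} → Der T (φ ∷ Δ) ψ → Der T Δ (φ ⊃ ψ)
  ⊃E    : ∀ {n m} {Δ : List (Form n m)} {φ ψ} → Der T Δ (φ ⊃ ψ) → Der T Δ φ → Der T Δ ψ
  raa   : ∀ {n m} {Δ : List (Form n m)} {φ} → Der T (¬' φ ∷ Δ) falsum → Der T Δ φ
  ∀iI   : ∀ {n m} {Δ : List (Form n m)} {φ} → Der T (map wkI Δ) φ → Der T Δ (∀i φ)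
  ∀iE   : ∀ {n m} {Δ : List (Form n m)} {φ} → Der T Δ (∀i φ) → (x : Fin n) → Der T Δ (instI φ x)
  ∀pI   : ∀ {n m} {Δ : List (Form n m)} {φ} → Der T (map wkP Δ) φ → Der T Δ (∀p φ)
  ∀pE   : ∀ {n m} {Δ : List (Form n m)} {φ} → Der T Δ (∀p φ) → (t : PTerm n m) → Der T Δ (instP φ t)
  ≐refl : ∀ {n m} {Δ : List (Form n m)} (x : Fin n) → Der T Δ (x ≐ x)
  ≐E    : ∀ {n m} {Δ : List (Form n m)} {x y} (φ : Form (suc n) m) →
          Der T Δ (x ≐ y) → Der T Δ (instI φ x) → Der T Δ (instI φ y)
  -- the individual domain is non-empty (standard classical first-order logic)
  nonempty : ∀ {n m} {Δ : List (Form n m)} {φ} → Der T (map wkI Δ) (wkI φ) → Der T Δ φ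

_⊢_ : ∀ {n m} → (Form 0 0 → Set) → Form n m → Set
T ⊢ φ = Der T [] φ

-- ATC + (Df.P_F) + (Df.A_F)   (together with the axiom characterising at_x)

data ATC : Form 0 0 → Set where
  ax-aa  : ATC (∀i ((# 0 ≺ aa) ⇔ ∀p (∀≺ (pvar (# 0)) (Fm (pvar (# 0)) (# 1) ⊃ (# 0 ≐ # 1)))))
  ax-atp : ATC (∀p (∀i ((# 0 ≺ atp (pvar (# 0))) ⇔
             ∃≺ (pvar (# 0)) (∃≼ aa (Fm (pvar (# 0)) (# 0) ∧' (# 1 ≺ pvar (# 0)))))))
  atc1   : ATC (∀i (∃≼ aa (Fm (pvar (# 0)) (# 0)
             ∧' ∀≼ aa (Fm (pvar (# 0)) (# 0) ⇔ (pvar (# 1) ≈ pvar (# 0)))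
             ∧' ∀i (Fm (pvar (# 0)) (# 0) ⊃ (# 1 ≐ # 0)))))
  atc2   : ATC (∀p (∀i (Fm (pvar (# 0)) (# 0) ⇔ Fm (atp (pvar (# 0))) (# 0))))
  ax-ati : ATC (∀i ((ati (# 0) ≼ aa)
             ∧' Fm (ati (# 0)) (# 0)
             ∧' ∀≼ aa (Fm (pvar (# 0)) (# 0) ⇔ (pvar (# 0) ≈ ati (# 0)))
             ∧' ∀i (Fm (ati (# 1)) (# 0) ⊃ (# 1 ≐ # 0))))
  df-PF  : ATC (∀i (∀i (Pm (# 1) (# 0) ⇔ (ati (# 1) ≼ ati (# 0)))))
  df-AF  : ATC (∀i (Am (# 0) ⇔ (# 0 ≺ aa)))

data AEMpl : Form 0 0 → Set where
  p-refl    : AEMpl (∀i (Pm (# 0) (# 0)))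
  p-trans   : AEMpl (∀i (∀i (∀i ((Pm (# 2) (# 1) ∧' Pm (# 1) (# 0)) ⊃ Pm (# 2) (# 0)))))
  p-antisym : AEMpl (∀i (∀i ((Pm (# 1) (# 0) ∧' Pm (# 0) (# 1)) ⊃ (# 1 ≐ # 0))))
  p-supp    : AEMpl (∀i (∀i (¬' Pm (# 1) (# 0) ⊃ ∃i (Pm (# 0) (# 2) ∧' ¬' Om (# 0) (# 1)))))
  df-A      : AEMpl (∀i (Am (# 0) ⇔ ∀i (Pm (# 0) (# 1) ⊃ (# 1 ≐ # 0))))
  df-F      : AEMpl (∀p (∀i (Fm (pvar (# 0)) (# 0) ⇔
                (∀≺ (pvar (# 0)) (Pm (# 0) (# 1))
                 ∧' ∀i (Pm (# 0) (# 1) ⊃ ∃≺ (pvar (# 0)) (Om (# 0) (# 1)))))))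
  atomic    : AEMpl (∀i (∃i (Pm (# 0) (# 1) ∧' Am (# 0))))
  df-aa     : AEMpl (∀i ((# 0 ≺ aa) ⇔ Am (# 0)))
  df-ati    : AEMpl (∀i (∀i ((# 0 ≺ ati (# 1)) ⇔ (Pm (# 0) (# 1) ∧' (# 0 ≺ aa)))))
  df-atp    : AEMpl (∀p (∀i ((# 0 ≺ atp (pvar (# 0))) ⇔
                ∃i ((# 0 ≺ pvar (# 0)) ∧' Pm (# 1) (# 0) ∧' (# 1 ≺ aa)))))

-- ATC is interpreted in AEM_pl by reading every ATC axiom as a theorem of
-- AEM_pl; derivations are then translated rule by rule.  The mereological
-- content lies in a few facts about the atoms at_x below x: they are non-empty
-- (atomicity), x is their fusion, and by strong supplementation x is
-- determined by them, so at_x ⊆ at_y already gives P x y.  With these, a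
-- plurality of atoms composing x must coincide with at_x, and a plurality and
-- the atoms below its members have the same fusions.
module Submission where

open import Defs
open import Data.Nat using (ℕ)
open import Data.Fin using (Fin; zero; suc)
open import Data.List using (List; _∷_; map)
open import Data.List.Relation.Unary.Any using (here; there)
open import Data.List.Relation.Binary.Subset.Propositional using (_⊆_)
open import Data.List.Relation.Binary.Subset.Propositional.Properties
  using (map⁺; ∷⁺ʳ; xs⊆x∷xs)
open import Relation.Binary.PropositionalEquality using (refl)

variable
  n m : ℕ
  T T' : Form 0 0 → Set
  Δ Δ' : List (Form n m)
  φ ψ χ θ ι : Form n m
  x y z : Fin n
  j : Fin m

Der-mono : Δ ⊆ Δ' → Der T Δ φ → Der T Δ' φ
Der-mono Δ⊆Δ' (ax t)         = ax t
Der-mono Δ⊆Δ' (hyp φ∈Δ)      = hyp (Δ⊆Δ' φ∈Δ)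
Der-mono Δ⊆Δ' (⊃I d)         = ⊃I (Der-mono (∷⁺ʳ _ Δ⊆Δ') d)
Der-mono Δ⊆Δ' (⊃E d e)       = ⊃E (Der-mono Δ⊆Δ' d) (Der-mono Δ⊆Δ' e)
Der-mono Δ⊆Δ' (raa d)        = raa (Der-mono (∷⁺ʳ _ Δ⊆Δ') d)
Der-mono Δ⊆Δ' (∀iI d)        = ∀iI (Der-mono (map⁺ wkI Δ⊆Δ') d)
Der-mono Δ⊆Δ' (∀iE d x)      = ∀iE (Der-mono Δ⊆Δ' d) x
Der-mono Δ⊆Δ' (∀pI d)        = ∀pI (Der-mono (map⁺ wkP Δ⊆Δ') d)
Der-mono Δ⊆Δ' (∀pE d t)      = ∀pE (Der-mono Δ⊆Δ' d) t
Der-mono Δ⊆Δ' (≐refl x)      = ≐refl x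
Der-mono Δ⊆Δ' (≐E φ d e)     = ≐E φ (Der-mono Δ⊆Δ' d) (Der-mono Δ⊆Δ' e)
Der-mono Δ⊆Δ' (nonempty d)   = nonempty (Der-mono (map⁺ wkI Δ⊆Δ') d)

Der-translate : (∀ {n m} {Δ : List (Form n m)} {ψ} → T ψ → Der T' Δ (close ψ)) →
                Der T Δ φ → Der T' Δ φ
Der-translate T⊢T' (ax t)       = T⊢T' t
Der-translate T⊢T' (hyp φ∈Δ)    = hyp φ∈Δ
Der-translate T⊢T' (⊃I d)       = ⊃I (Der-translate T⊢T' d)
Der-translate T⊢T' (⊃E d e)     = ⊃E (Der-translate T⊢T' d) (Der-translate T⊢T' e)
Der-translate T⊢T' (raa d)      = raa (Der-translate T⊢T' d)
Der-translate T⊢T' (∀iI d)      = ∀iI (Der-translate T⊢T' d)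
Der-translate T⊢T' (∀iE d x)    = ∀iE (Der-translate T⊢T' d) x
Der-translate T⊢T' (∀pI d)      = ∀pI (Der-translate T⊢T' d)
Der-translate T⊢T' (∀pE d t)    = ∀pE (Der-translate T⊢T' d) t
Der-translate T⊢T' (≐refl x)    = ≐refl x
Der-translate T⊢T' (≐E φ d e)   = ≐E φ (Der-translate T⊢T' d) (Der-translate T⊢T' e)
Der-translate T⊢T' (nonempty d) = nonempty (Der-translate T⊢T' d)

h₀ : Der T (φ ∷ Δ) φ
h₀ = hyp (here refl)

h₁ : Der T (ψ ∷ φ ∷ Δ) φ
h₁ = hyp (there (here refl))

h₂ : Der T (χ ∷ ψ ∷ φ ∷ Δ) φ
h₂ = hyp (there (there (here refl)))

h₃ : Der T (θ ∷ χ ∷ ψ ∷ φ ∷ Δ) φ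
h₃ = hyp (there (there (there (here refl))))

h₄ : Der T (ι ∷ θ ∷ χ ∷ ψ ∷ φ ∷ Δ) φ
h₄ = hyp (there (there (there (there (here refl)))))

weaken : Der T Δ φ → Der T (ψ ∷ Δ) φ
weaken = Der-mono (xs⊆x∷xs _ _)

cut : Der T Δ φ → Der T (φ ∷ Δ) ψ → Der T Δ ψ
cut d e = ⊃E (⊃I e) d

⊥-elim : Der T Δ falsum → Der T Δ φ
⊥-elim d = raa (weaken d)

contradiction : Der T Δ φ → Der T Δ (¬' φ) → Der T Δ ψ
contradiction d e = ⊥-elim (⊃E e d)

∧I : Der T Δ φ → Der T Δ ψ → Der T Δ (φ ∧' ψ)
∧I d e = ⊃I (⊃E (⊃E h₀ (weaken d)) (weaken e))

∧E₁ : Der T Δ (φ ∧' ψ) → Der T Δ φ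
∧E₁ d = raa (⊃E (weaken d) (⊃I (contradiction h₀ h₁)))

∧E₂ : Der T Δ (φ ∧' ψ) → Der T Δ ψ
∧E₂ d = raa (⊃E (weaken d) (⊃I h₁))

⇔I : Der T (φ ∷ Δ) ψ → Der T (ψ ∷ Δ) φ → Der T Δ (φ ⇔ ψ)
⇔I d e = ∧I (⊃I d) (⊃I e)

⇔E₁ : Der T Δ (φ ⇔ ψ) → Der T Δ φ → Der T Δ ψ
⇔E₁ d = ⊃E (∧E₁ d)

⇔E₂ : Der T Δ (φ ⇔ ψ) → Der T Δ ψ → Der T Δ φ
⇔E₂ d = ⊃E (∧E₂ d)

∃iI : (x : Fin n) → Der T Δ (instI φ x) → Der T Δ (∃i φ)
∃iI x d = ⊃I (⊃E (∀iE h₀ x) (weaken d))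

∃iE : Der T Δ (∃i φ) → Der T (φ ∷ map wkI Δ) (wkI ψ) → Der T Δ ψ
∃iE d e = raa (⊃E (weaken d) (∀iI (⊃I (⊃E h₁ (Der-mono (∷⁺ʳ _ (xs⊆x∷xs _ _)) e)))))

∃pI : (t : PTerm n m) → Der T Δ (instP φ t) → Der T Δ (∃p φ)
∃pI t d = ⊃I (⊃E (∀pE h₀ t) (weaken d))

∃pE : Der T Δ (∃p φ) → Der T (φ ∷ map wkP Δ) (wkP ψ) → Der T Δ ψ
∃pE d e = raa (⊃E (weaken d) (∀pI (⊃I (⊃E h₁ (Der-mono (∷⁺ʳ _ (xs⊆x∷xs _ _)) e)))))

≐-sym : Der T Δ (x ≐ y) → Der T Δ (y ≐ x)
≐-sym {x = x} d = ≐E (zero ≐ suc x) d (≐refl x)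

≐-trans : Der T Δ (x ≐ y) → Der T Δ (y ≐ z) → Der T Δ (x ≐ z)
≐-trans {x = x} d e = ≐E (suc x ≐ zero) e d

-- Plural terms of these shapes are those on which weakening and
-- instantiation compute, so a general axiom instantiated at them unfolds.
data Shape (n m : ℕ) : Set where
  var  : Fin m → Shape n m
  atI  : Fin n → Shape n m
  atPV : Fin m → Shape n m

⟦_⟧ : Shape n m → PTerm n m
⟦ var j ⟧  = pvar j
⟦ atI x ⟧  = ati x
⟦ atPV j ⟧ = atp (pvar j)

D : List (Form n m) → Form n m → Set
D = Der AEMpl

P-refl : (x : Fin n) → D Δ (Pm x x)
P-refl x = ∀iE (ax p-refl) x

P-trans : D Δ (Pm x y) → D Δ (Pm y z) → D Δ (Pm x z)
P-trans {x = x} {y} {z} d e = ⊃E (∀iE (∀iE (∀iE (ax p-trans) x) y) z) (∧I d e)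

P-antisym : D Δ (Pm x y) → D Δ (Pm y x) → D Δ (x ≐ y)
P-antisym {x = x} {y} d e = ⊃E (∀iE (∀iE (ax p-antisym) x) y) (∧I d e)

O-intro : D Δ (Pm z x) → D Δ (Pm z y) → D Δ (Om x y)
O-intro {z = z} d e = ∃iI z (∧I d e)

supplementation : D Δ (¬' Pm x y) → D Δ (∃i (Pm zero (suc x) ∧' ¬' Om zero (suc y)))
supplementation {x = x} {y} = ⊃E (∀iE (∀iE (ax p-supp) x) y)

atom-below : (x : Fin n) → D Δ (∃i (Pm zero (suc x) ∧' Am zero))
atom-below = ∀iE (ax atomic)

≺aa⇒A : D Δ (x ≺ aa) → D Δ (Am x)
≺aa⇒A {x = x} = ⇔E₁ (∀iE (ax df-aa) x)

A⇒≺aa : D Δ (Am x) → D Δ (x ≺ aa)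
A⇒≺aa {x = x} = ⇔E₂ (∀iE (ax df-aa) x)

atom-P⇒≐ : D Δ (x ≺ aa) → D Δ (Pm y x) → D Δ (x ≐ y)
atom-P⇒≐ {x = x} {y = y} d = ⊃E (∀iE (⇔E₁ (∀iE (ax df-A) x) (≺aa⇒A d)) y)

≺ati⁺ : D Δ (Pm y x) → D Δ (y ≺ aa) → D Δ (y ≺ ati x)
≺ati⁺ {y = y} {x = x} d e = ⇔E₂ (∀iE (∀iE (ax df-ati) x) y) (∧I d e)

≺ati⇒P : D Δ (y ≺ ati x) → D Δ (Pm y x)
≺ati⇒P {y = y} {x = x} d = ∧E₁ (⇔E₁ (∀iE (∀iE (ax df-ati) x) y) d)

≺ati⇒≺aa : D Δ (y ≺ ati x) → D Δ (y ≺ aa)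
≺ati⇒≺aa {y = y} {x = x} d = ∧E₂ (⇔E₁ (∀iE (∀iE (ax df-ati) x) y) d)

≺atp⁺ : D Δ (z ≺ pvar j) → D Δ (Pm y z) → D Δ (y ≺ aa) → D Δ (y ≺ atp (pvar j))
≺atp⁺ {z = z} {j = j} {y = y} d e f =
  ⇔E₂ (∀iE (∀pE (ax df-atp) (pvar j)) y) (∃iI z (∧I d (∧I e f)))

≺atp⁻ : D Δ (y ≺ atp (pvar j)) →
        D Δ (∃i ((zero ≺ pvar j) ∧' Pm (suc y) zero ∧' (suc y ≺ aa)))
≺atp⁻ {y = y} {j = j} = ⇔E₁ (∀iE (∀pE (ax df-atp) (pvar j)) y)

F⇒P : (s : Shape n m) {x z : Fin n} → D Δ (Fm ⟦ s ⟧ x) → D Δ (z ≺ ⟦ s ⟧) → D Δ (Pm z x)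
F⇒P (var j)  {x} {z} d = ⊃E (∀iE (∧E₁ (⇔E₁ (∀iE (∀pE (ax df-F) (pvar j)) x) d)) z)
F⇒P (atI y)  {x} {z} d = ⊃E (∀iE (∧E₁ (⇔E₁ (∀iE (∀pE (ax df-F) (ati y)) x) d)) z)
F⇒P (atPV j) {x} {z} d = ⊃E (∀iE (∧E₁ (⇔E₁ (∀iE (∀pE (ax df-F) (atp (pvar j))) x) d)) z)

F⇒overlap : (s : Shape n m) {x y : Fin n} → D Δ (Fm ⟦ s ⟧ x) → D Δ (Pm y x) →
            D Δ (∃i ((zero ≺ wkTI ⟦ s ⟧) ∧' Om zero (suc y)))
F⇒overlap (var j)  {x} {y} d = ⊃E (∀iE (∧E₂ (⇔E₁ (∀iE (∀pE (ax df-F) (pvar j)) x) d)) y)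
F⇒overlap (atI z)  {x} {y} d = ⊃E (∀iE (∧E₂ (⇔E₁ (∀iE (∀pE (ax df-F) (ati z)) x) d)) y)
F⇒overlap (atPV j) {x} {y} d = ⊃E (∀iE (∧E₂ (⇔E₁ (∀iE (∀pE (ax df-F) (atp (pvar j))) x) d)) y)

F-intro : (s : Shape n m) {x : Fin n} →
          D Δ (∀i ((zero ≺ wkTI ⟦ s ⟧) ⊃ Pm zero (suc x))) →
          D Δ (∀i (Pm zero (suc x) ⊃ ∃i ((zero ≺ wkTI (wkTI ⟦ s ⟧)) ∧' Om zero (suc zero)))) →
          D Δ (Fm ⟦ s ⟧ x)
F-intro (var j)  {x} d e = ⇔E₂ (∀iE (∀pE (ax df-F) (pvar j)) x) (∧I d e)
F-intro (atI y)  {x} d e = ⇔E₂ (∀iE (∀pE (ax df-F) (ati y)) x) (∧I d e)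
F-intro (atPV j) {x} d e = ⇔E₂ (∀iE (∀pE (ax df-F) (atp (pvar j))) x) (∧I d e)

ati-nonempty : (x : Fin n) → D Δ (∃i (zero ≺ ati (suc x)))
ati-nonempty x = ∃iE (atom-below x) (∃iI zero (≺ati⁺ (∧E₁ h₀) (A⇒≺aa (∧E₂ h₀))))

ati≼aa : (x : Fin n) → D Δ (ati x ≼ aa)
ati≼aa x = ∧I (∀iI (⊃I (≺ati⇒≺aa h₀))) (ati-nonempty x)

-- Every part y of x contains an atom, which is one of at_x and overlaps y.
F-ati : (x : Fin n) → D Δ (Fm (ati x) x)
F-ati x = F-intro (atI x) (∀iI (⊃I (≺ati⇒P h₀)))
  (∀iI (⊃I (∃iE (atom-below zero)
     (∃iI zero (∧I (≺ati⁺ (P-trans (∧E₁ h₀) h₁) (A⇒≺aa (∧E₂ h₀)))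
                   (O-intro (P-refl zero) (∧E₁ h₀)))))))

-- If ¬ P x y, supplementation gives a part z of x disjoint from y; an atom
-- below z is one of at_x, hence of at_y, so z overlaps y after all.
ati⊆ati⇒P : D Δ (∀i ((zero ≺ ati (suc x)) ⊃ (zero ≺ ati (suc y)))) → D Δ (Pm x y)
ati⊆ati⇒P at⊆ = cut at⊆ (raa (∃iE (supplementation h₀) (∃iE (atom-below zero)
  (⊃E (∧E₂ h₁)
      (O-intro (∧E₁ h₀)
        (≺ati⇒P (⊃E (∀iE h₃ zero)
          (≺ati⁺ (P-trans (∧E₁ h₀) (∧E₁ h₁)) (A⇒≺aa (∧E₂ h₀))))))))))

F-ati⇒≐ : D Δ (Fm (ati x) y) → D Δ (x ≐ y)
F-ati⇒≐ {x = x} F = P-antisym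
  (ati⊆ati⇒P (cut F (∀iI (⊃I (≺ati⁺ (F⇒P (atI (suc x)) h₁ h₀) (≺ati⇒≺aa h₀))))))
  (cut F (raa (∃iE (supplementation h₀) (∃iE (F⇒overlap (atI (suc x)) h₂ (∧E₁ h₀))
     (∃iE (∧E₂ h₀)
       (⊃E (∧E₂ h₂) (O-intro (∧E₂ h₀) (P-trans (∧E₁ h₀) (≺ati⇒P (∧E₁ h₁))))))))))

-- A member z of yy is an atom below x; conversely an atom a below x overlaps
-- some member of yy, and two overlapping atoms are equal.
F⇒≈ati : D Δ (pvar j ≼ aa) → D Δ (Fm (pvar j) x) → D Δ (pvar j ≈ ati x)
F⇒≈ati {j = j} yy≼aa F = cut yy≼aa (cut (weaken F) (∀iI (⇔I
  (≺ati⁺ (F⇒P (var j) h₁ h₀) (⊃E (∀iE (∧E₁ h₂) zero) h₀))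
  (∃iE (F⇒overlap (var j) h₁ (≺ati⇒P h₀))
    (∃iE (∧E₂ h₀)
      (≐E (zero ≺ pvar j)
        (≐-sym (≐-trans (atom-P⇒≐ (≺ati⇒≺aa h₂) (∧E₂ h₀))
                        (≐-sym (atom-P⇒≐ (⊃E (∀iE (∧E₁ h₄) (suc zero)) (∧E₁ h₁)) (∧E₁ h₀)))))
        (∧E₁ h₁)))))))

≈ati⇒F : D Δ (pvar j ≈ ati x) → D Δ (Fm (pvar j) x)
≈ati⇒F {j = j} {x = x} E = cut E (F-intro (var j)
  (∀iI (⊃I (≺ati⇒P (⇔E₁ (∀iE h₁ zero) h₀))))
  (∀iI (⊃I (∃iE (F⇒overlap (atI (suc x)) (F-ati (suc x)) h₀)
     (∃iI zero (∧I (⇔E₂ (∀iE h₂ zero) (∧E₁ h₀)) (∧E₂ h₀)))))))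

pvar≈ati-sym : D Δ (pvar j ≈ ati x) → D Δ (ati x ≈ pvar j)
pvar≈ati-sym E = cut E (∀iI (⇔I (⇔E₂ (∀iE h₁ zero) h₀) (⇔E₁ (∀iE h₁ zero) h₀)))

ati≈pvar-sym : D Δ (ati x ≈ pvar j) → D Δ (pvar j ≈ ati x)
ati≈pvar-sym E = cut E (∀iI (⇔I (⇔E₂ (∀iE h₁ zero) h₀) (⇔E₁ (∀iE h₁ zero) h₀)))

F⇒F-atp : D Δ (Fm (pvar j) x) → D Δ (Fm (atp (pvar j)) x)
F⇒F-atp {j = j} F = cut F (F-intro (atPV j)
  (∀iI (⊃I (∃iE (≺atp⁻ h₀) (P-trans (∧E₁ (∧E₂ h₀)) (F⇒P (var j) h₂ (∧E₁ h₀))))))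
  (∀iI (⊃I (∃iE (F⇒overlap (var j) h₁ h₀)
     (∃iE (∧E₂ h₀) (∃iE (atom-below zero)
       (∃iI zero (∧I (≺atp⁺ (∧E₁ h₂) (P-trans (∧E₁ h₀) (∧E₁ h₁)) (A⇒≺aa (∧E₂ h₀)))
                     (O-intro (P-refl zero) (P-trans (∧E₁ h₀) (∧E₂ h₁)))))))))))

F-atp⇒F : D Δ (Fm (atp (pvar j)) x) → D Δ (Fm (pvar j) x)
F-atp⇒F {j = j} F = cut F (F-intro (var j)
  (∀iI (⊃I (raa (∃iE (supplementation h₀) (∃iE (atom-below zero)
     (⊃E (∧E₂ h₁)
       (O-intro (∧E₁ h₀)
         (F⇒P (atPV j) h₄ (≺atp⁺ h₃ (P-trans (∧E₁ h₀) (∧E₁ h₁)) (A⇒≺aa (∧E₂ h₀)))))))))))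
  (∀iI (⊃I (∃iE (F⇒overlap (atPV j) h₁ h₀)
     (∃iE (≺atp⁻ (∧E₁ h₀))
       (∃iE (∧E₂ h₁)
         (∃iI (suc zero) (∧I (∧E₁ h₁) (O-intro (P-trans (∧E₁ h₀) (∧E₁ (∧E₂ h₁))) (∧E₂ h₀))))))))))

ATC-axiom-derivable : ATC ψ → D Δ (close ψ)
ATC-axiom-derivable ax-aa = ∀iI (⇔I
  (∀pI (∀iI (⊃I (⊃I (≐-sym (atom-P⇒≐ h₂ (F⇒P (var zero) h₀ h₁)))))))
  -- an atom below x is one of at_x, which composes x, so it is x itself
  (∃iE (atom-below zero)
    (≐E (zero ≺ aa)
      (⊃E (⊃E (∀iE (∀pE h₁ (ati (suc zero))) zero) (≺ati⁺ (∧E₁ h₀) (A⇒≺aa (∧E₂ h₀))))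
          (F-ati (suc zero)))
      (A⇒≺aa (∧E₂ h₀)))))
ATC-axiom-derivable ax-atp = ∀pI (∀iI (⇔I
  (∃iE (≺atp⁻ h₀)
    (∃iI zero (∧I (∧E₁ h₀) (∃pI (ati zero) (∧I (ati≼aa zero) (∧I (F-ati zero)
      (≺ati⁺ (∧E₁ (∧E₂ h₀)) (∧E₂ (∧E₂ h₀)))))))))
  (∃iE h₀ (∃pE (∧E₂ h₀)
    (≺atp⁺ (∧E₁ h₁) (F⇒P (var zero) (∧E₁ (∧E₂ h₀)) (∧E₂ (∧E₂ h₀)))
           (⊃E (∀iE (∧E₁ (∧E₁ h₀)) (suc zero)) (∧E₂ (∧E₂ h₀))))))))
ATC-axiom-derivable atc1 = ∀iI (∃pI (ati zero) (∧I (ati≼aa zero) (∧I (F-ati zero) (∧I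
  (∀pI (⊃I (⇔I (pvar≈ati-sym (F⇒≈ati h₁ h₀)) (≈ati⇒F (ati≈pvar-sym h₀)))))
  (∀iI (⊃I (F-ati⇒≐ h₀)))))))
ATC-axiom-derivable atc2 = ∀pI (∀iI (⇔I (F⇒F-atp h₀) (F-atp⇒F h₀)))
ATC-axiom-derivable ax-ati = ∀iI (∧I (ati≼aa zero) (∧I (F-ati zero) (∧I
  (∀pI (⊃I (⇔I (F⇒≈ati h₁ h₀) (≈ati⇒F h₀))))
  (∀iI (⊃I (F-ati⇒≐ h₀))))))
ATC-axiom-derivable df-PF = ∀iI (∀iI (⇔I
  (∧I (∀iI (⊃I (≺ati⁺ (P-trans (≺ati⇒P h₀) h₁) (≺ati⇒≺aa h₀)))) (ati-nonempty (suc zero)))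
  (ati⊆ati⇒P (∧E₁ h₀))))
ATC-axiom-derivable df-AF = ∀iI (⇔I (A⇒≺aa h₀) (≺aa⇒A h₀))

theorem2 : ∀ {n m : ℕ} (φ : Form n m) → ATC ⊢ φ → AEMpl ⊢ φ
theorem2 φ = Der-translate ATC-axiom-derivable
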